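{- Let $(x_m)_{m\ge0}$, $(y_n)_{n\ge1}$, $(z_m)_{m\ge0}$ be elements of a commutative ring and let $(a_{n,m})_{n,m\ge 0}$ be defined by $a_{0,m}=x_m$ for $m\ge0$ and $$a_{n,m}=z_ma_{n-1,m+1}+y_na_{n-1,m}\qquad(n\ge1,\ m\ge0).$$ Then for all $n,m\ge0$, $$a_{n,m}=\sum_{k=0}^n x_{m+k}\,(z_mz_{m+1}\cdots z_{m+k-1})\,e_{n-k}(y_1,y_2,\ldots, y_n),$$ where $e_i$ denotes the $i$-th elementary symmetric polynomial (and the empty product is $1$). -}

module Defs where

open import Level using (Level)
open import Algebra.Bundles using (CommutativeRing)
open import Data.Nat using (ℕ; zero; suc)
open import Data.Bool using (Bool; true; false)
open import Data.List using (List; []; _∷_; map; _++_; filter)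
open import Data.Vec using (Vec; []; _∷_; count)
import Data.Nat as ℕ

-- all subsets of {1,…,n}, encoded as characteristic vectors (position j ↔ element j+1)
subsets : (n : ℕ) → List (Vec Bool n)
subsets zero = [] ∷ []
subsets (suc n) = map (false ∷_) (subsets n) ++ map (true ∷_) (subsets n)

card : ∀ {n} → Vec Bool n → ℕ
card [] = 0
card (false ∷ s) = card s
card (true ∷ s) = suc (card s)

module _ {c ℓ : Level} (R : CommutativeRing c ℓ) where
  open CommutativeRing R

  sumL : List Carrier → Carrier
  sumL [] = 0#
  sumL (x ∷ xs) = x + sumL xs

  sumTo : ℕ → (ℕ → Carrier) → Carrier
  sumTo zero f = f 0
  sumTo (suc n) f = sumTo n f + f (suc n)

  prodFrom : (ℕ → Carrier) → ℕ → ℕ → Carrier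
  prodFrom z m zero = 1#
  prodFrom z m (suc k) = z m * prodFrom z (suc m) k

  -- product of y_j over the j ∈ S, S ⊆ {o+1,…,o+n} encoded by its characteristic vector
  prodSub : (ℕ → Carrier) → ℕ → ∀ {n} → Vec Bool n → Carrier
  prodSub y o [] = 1#
  prodSub y o (false ∷ s) = prodSub y (suc o) s
  prodSub y o (true ∷ s) = y (suc o) * prodSub y (suc o) s

  esym : ℕ → (ℕ → Carrier) → ℕ → Carrier
  esym n y i = sumL (map (prodSub y 0) (filter (λ s → card s ℕ.≟ i) (subsets n)))

  arr : (x y z : ℕ → Carrier) → ℕ → ℕ → Carrier
  arr x y z zero m = x m
  arr x y z (suc n) m = z m * arr x y z n (suc m) + y (suc n) * arr x y z n m

-- Write c_{m,k} = x_{m+k} z_m ⋯ z_{m+k-1} and D(n, d, m) = Σ_{k ≤ d} c_{m,k} e_{d-k}(y_1,…,y_n).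
-- The claim is a_{n,m} = D(n, n, m), by induction on n.  Two identities drive the step:
-- peeling off the first summand, D(n, d+1, m) = z_m D(n, d, m+1) whenever n ≤ d
-- (because e_{d+1} of n variables vanishes and c_{m,k+1} = z_m c_{m+1,k}), and adjoining
-- the variable y_{n+1}, D(n+1, d+1, m) = D(n, d+1, m) + y_{n+1} D(n, d, m), which is the
-- recurrence e_{i+1}(y_1,…,y_{n+1}) = e_{i+1}(y_1,…,y_n) + y_{n+1} e_i(y_1,…,y_n).
-- Since the subsets are enumerated by their first element, e_i is first computed by the
-- recurrence in y_1, and the recurrence in the last variable is derived from it.
module Submission where

open import Defs
open import Level using (Level)
open import Algebra.Bundles using (CommutativeRing)
open import Data.Nat using (ℕ; zero; suc; _≤_; _<_; _∸_; z≤n; s≤s)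
import Data.Nat as ℕ
import Data.Nat.Properties as ℕₚ
open import Data.Bool using (Bool; true; false; if_then_else_)
open import Data.List using (List; []; _∷_; map; _++_; filter)
open import Data.List.Properties using (map-++; map-∘)
open import Data.Vec using (Vec; []; _∷_)
open import Function using (_∘_)
open import Relation.Nullary using (does)
open import Relation.Unary using (Pred; Decidable)
open import Relation.Binary.PropositionalEquality as ≡ using (_≡_)
import Relation.Binary.Reasoning.Setoid as SetoidReasoning
import Algebra.Properties.CommutativeSemigroup as CommutativeSemigroupProperties

module _ {c ℓ : Level} (R : CommutativeRing c ℓ) where
  open CommutativeRing R hiding (zero)
  open SetoidReasoning setoid
  open CommutativeSemigroupProperties +-commutativeSemigroup using (interchange; xy∙z≈xz∙y)
  open CommutativeSemigroupProperties *-commutativeSemigroup using (x∙yz≈y∙xz)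
  open import Algebra.Solver.Ring.NaturalCoefficients.Default commutativeSemiring using (solve; _:+_; _:*_; _:=_)

  sumL-++ : (xs ys : List Carrier) → sumL R (xs ++ ys) ≈ sumL R xs + sumL R ys
  sumL-++ [] ys = sym (+-identityˡ _)
  sumL-++ (x ∷ xs) ys = trans (+-cong refl (sumL-++ xs ys)) (sym (+-assoc _ _ _))

  sumL-map-cong : ∀ {A : Set} {f g : A → Carrier} → (∀ a → f a ≈ g a) →
    (xs : List A) → sumL R (map f xs) ≈ sumL R (map g xs)
  sumL-map-cong f≈g [] = refl
  sumL-map-cong f≈g (x ∷ xs) = +-cong (f≈g x) (sumL-map-cong f≈g xs)

  sumL-map-0# : ∀ {A : Set} (xs : List A) → sumL R (map (λ _ → 0#) xs) ≈ 0#
  sumL-map-0# [] = refl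
  sumL-map-0# (x ∷ xs) = trans (+-identityˡ _) (sumL-map-0# xs)

  sumL-map-*ˡ : ∀ {A : Set} a (f : A → Carrier) (xs : List A) →
    sumL R (map (λ s → a * f s) xs) ≈ a * sumL R (map f xs)
  sumL-map-*ˡ a f [] = sym (zeroʳ a)
  sumL-map-*ˡ a f (x ∷ xs) = trans (+-cong refl (sumL-map-*ˡ a f xs)) (sym (distribˡ a _ _))

  sumL-map-filter : ∀ {A : Set} {p} {P : Pred A p} (P? : Decidable P) (f : A → Carrier) (xs : List A) →
    sumL R (map f (filter P? xs)) ≈ sumL R (map (λ s → if does (P? s) then f s else 0#) xs)
  sumL-map-filter P? f [] = refl
  sumL-map-filter P? f (x ∷ xs) with does (P? x)
  ... | true = +-cong refl (sumL-map-filter P? f xs)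
  ... | false = trans (sumL-map-filter P? f xs) (sym (+-identityˡ _))

  if-*ˡ : ∀ (b : Bool) a p → (if b then a * p else 0#) ≈ a * (if b then p else 0#)
  if-*ˡ true a p = refl
  if-*ˡ false a p = sym (zeroʳ a)

  sumTo-cong : ∀ n {f g : ℕ → Carrier} → (∀ k → k ≤ n → f k ≈ g k) → sumTo R n f ≈ sumTo R n g
  sumTo-cong zero f≈g = f≈g 0 z≤n
  sumTo-cong (suc n) f≈g = +-cong (sumTo-cong n (λ k k≤n → f≈g k (ℕₚ.m≤n⇒m≤1+n k≤n))) (f≈g (suc n) ℕₚ.≤-refl)

  sumTo-+ : ∀ n (f g : ℕ → Carrier) → sumTo R n (λ k → f k + g k) ≈ sumTo R n f + sumTo R n g
  sumTo-+ zero f g = refl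
  sumTo-+ (suc n) f g = trans (+-cong (sumTo-+ n f g) refl) (interchange _ _ _ _)

  sumTo-*ˡ : ∀ n a (f : ℕ → Carrier) → sumTo R n (λ k → a * f k) ≈ a * sumTo R n f
  sumTo-*ˡ zero a f = refl
  sumTo-*ˡ (suc n) a f = trans (+-cong (sumTo-*ˡ n a f) refl) (sym (distribˡ a _ _))

  sumTo-suc : ∀ n (f : ℕ → Carrier) → sumTo R (suc n) f ≈ f 0 + sumTo R n (f ∘ suc)
  sumTo-suc zero f = refl
  sumTo-suc (suc n) f = trans (+-cong (sumTo-suc n f) refl) (+-assoc _ _ _)

  prodSub-shift : ∀ y o {n} (s : Vec Bool n) → prodSub R y (suc o) s ≡ prodSub R (y ∘ suc) o s
  prodSub-shift y o [] = ≡.refl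
  prodSub-shift y o (false ∷ s) = prodSub-shift y (suc o) s
  prodSub-shift y o (true ∷ s) = ≡.cong (y (suc (suc o)) *_) (prodSub-shift y (suc o) s)

  esymRec : (ℕ → Carrier) → ℕ → ℕ → Carrier
  esymRec y n zero = 1#
  esymRec y zero (suc i) = 0#
  esymRec y (suc n) (suc i) = esymRec (y ∘ suc) n (suc i) + y 1 * esymRec (y ∘ suc) n i

  esymRec-vanishes : ∀ y {n i} → n < i → esymRec y n i ≈ 0#
  esymRec-vanishes y {zero} {suc i} _ = refl
  esymRec-vanishes y {suc n} {suc i} (s≤s n<i) = begin
    esymRec (y ∘ suc) n (suc i) + y 1 * esymRec (y ∘ suc) n i
      ≈⟨ +-cong (esymRec-vanishes (y ∘ suc) (ℕₚ.m<n⇒m<1+n n<i)) (*-cong refl (esymRec-vanishes (y ∘ suc) n<i)) ⟩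
    0# + y 1 * 0#
      ≈⟨ trans (+-identityˡ _) (zeroʳ _) ⟩
    0# ∎

  esymRec-snoc : ∀ y n i → esymRec y (suc n) (suc i) ≈ esymRec y n (suc i) + y (suc n) * esymRec y n i
  esymRec-snoc y zero zero = refl
  esymRec-snoc y zero (suc i) = refl
  esymRec-snoc y (suc n) zero =
    trans (+-cong (esymRec-snoc (y ∘ suc) n zero) refl) (xy∙z≈xz∙y _ _ _)
  esymRec-snoc y (suc n) (suc i) = begin
    e′ (suc n) (suc (suc i)) + y 1 * e′ (suc n) (suc i)
      ≈⟨ +-cong (esymRec-snoc (y ∘ suc) n (suc i)) (*-cong refl (esymRec-snoc (y ∘ suc) n i)) ⟩
    (e′ n (suc (suc i)) + y (2 ℕ.+ n) * e′ n (suc i)) + y 1 * (e′ n (suc i) + y (2 ℕ.+ n) * e′ n i)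
      ≈⟨ swapVariables _ _ _ _ _ ⟩
    (e′ n (suc (suc i)) + y 1 * e′ n (suc i)) + y (2 ℕ.+ n) * (e′ n (suc i) + y 1 * e′ n i) ∎
    where
    e′ : ℕ → ℕ → Carrier
    e′ = esymRec (y ∘ suc)
    swapVariables : ∀ A B C u v → (A + v * B) + u * (B + v * C) ≈ (A + u * B) + v * (B + u * C)
    swapVariables = solve 5 (λ A B C u v →
      (A :+ v :* B) :+ u :* (B :+ v :* C) := (A :+ u :* B) :+ v :* (B :+ u :* C)) refl

  monomialOfDegree : (ℕ → Carrier) → ℕ → ∀ {n} → Vec Bool n → Carrier
  monomialOfDegree y i s = if does (card s ℕ.≟ i) then prodSub R y 0 s else 0#

  sum-monomialOfDegree : ∀ y n i → sumL R (map (monomialOfDegree y i) (subsets n)) ≈ esymRec y n i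
  sum-monomialOfDegree y zero zero = +-identityʳ 1#
  sum-monomialOfDegree y zero (suc i) = +-identityʳ 0#
  sum-monomialOfDegree y (suc n) i = trans split (cases i)
    where
    ss : List (Vec Bool n)
    ss = subsets n

    withHead : Bool → ℕ → Carrier
    withHead b j = sumL R (map (monomialOfDegree y j ∘ (b ∷_)) ss)

    split : sumL R (map (monomialOfDegree y i) (subsets (suc n))) ≈ withHead false i + withHead true i
    split = begin
      sumL R (map (monomialOfDegree y i) (map (false ∷_) ss ++ map (true ∷_) ss))
        ≡⟨ ≡.cong (sumL R) (map-++ (monomialOfDegree y i) (map (false ∷_) ss) (map (true ∷_) ss)) ⟩
      sumL R (map (monomialOfDegree y i) (map (false ∷_) ss) ++ map (monomialOfDegree y i) (map (true ∷_) ss))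
        ≈⟨ sumL-++ (map (monomialOfDegree y i) (map (false ∷_) ss)) (map (monomialOfDegree y i) (map (true ∷_) ss)) ⟩
      sumL R (map (monomialOfDegree y i) (map (false ∷_) ss)) + sumL R (map (monomialOfDegree y i) (map (true ∷_) ss))
        ≡⟨ ≡.sym (≡.cong₂ (λ u v → sumL R u + sumL R v) (map-∘ ss) (map-∘ ss)) ⟩
      withHead false i + withHead true i ∎

    dropFalse : ∀ j → withHead false j ≈ esymRec (y ∘ suc) n j
    dropFalse j = trans
      (sumL-map-cong (λ s → reflexive (≡.cong (λ p → if does (card s ℕ.≟ j) then p else 0#) (prodSub-shift y 0 s))) ss)
      (sum-monomialOfDegree (y ∘ suc) n j)

    cases : ∀ i → withHead false i + withHead true i ≈ esymRec y (suc n) i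
    cases zero = trans (+-cong (dropFalse zero) (sumL-map-0# ss)) (+-identityʳ 1#)
    cases (suc j) = +-cong (dropFalse (suc j)) (begin
      withHead true (suc j)
        ≈⟨ sumL-map-cong (λ s → if-*ˡ (does (card s ℕ.≟ j)) (y 1) (prodSub R y 1 s)) ss ⟩
      sumL R (map (λ s → y 1 * (if does (card s ℕ.≟ j) then prodSub R y 1 s else 0#)) ss)
        ≈⟨ sumL-map-*ˡ (y 1) _ ss ⟩
      y 1 * withHead false j
        ≈⟨ *-cong refl (dropFalse j) ⟩
      y 1 * esymRec (y ∘ suc) n j ∎)

  esym≈esymRec : ∀ y n i → esym R n y i ≈ esymRec y n i
  esym≈esymRec y n i = trans (sumL-map-filter (λ s → card s ℕ.≟ i) (prodSub R y 0) (subsets n)) (sum-monomialOfDegree y n i)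

  module ClosedForm (x y z : ℕ → Carrier) where

    coeff : ℕ → ℕ → Carrier
    coeff m k = x (m ℕ.+ k) * prodFrom R z m k

    coeff-suc : ∀ m k → coeff m (suc k) ≈ z m * coeff (suc m) k
    coeff-suc m k = begin
      x (m ℕ.+ suc k) * (z m * prodFrom R z (suc m) k)
        ≡⟨ ≡.cong (λ j → x j * (z m * prodFrom R z (suc m) k)) (ℕₚ.+-suc m k) ⟩
      x (suc m ℕ.+ k) * (z m * prodFrom R z (suc m) k)
        ≈⟨ x∙yz≈y∙xz _ _ _ ⟩
      z m * coeff (suc m) k ∎

    convolution : ℕ → ℕ → ℕ → Carrier
    convolution n d m = sumTo R d (λ k → coeff m k * esymRec y n (d ∸ k))

    convolution-suc-degree : ∀ {n d} m → n ≤ d → convolution n (suc d) m ≈ z m * convolution n d (suc m)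
    convolution-suc-degree {n} {d} m n≤d = begin
      convolution n (suc d) m
        ≈⟨ sumTo-suc d _ ⟩
      coeff m 0 * esymRec y n (suc d) + sumTo R d (λ k → coeff m (suc k) * esymRec y n (d ∸ k))
        ≈⟨ +-cong (trans (*-cong refl (esymRec-vanishes y (s≤s n≤d))) (zeroʳ _))
                  (sumTo-cong d (λ k _ → trans (*-cong (coeff-suc m k) refl) (*-assoc _ _ _))) ⟩
      0# + sumTo R d (λ k → z m * (coeff (suc m) k * esymRec y n (d ∸ k)))
        ≈⟨ trans (+-identityˡ _) (sumTo-*ˡ d (z m) _) ⟩
      z m * convolution n d (suc m) ∎

    convolution-suc-vars : ∀ n d m →
      convolution (suc n) (suc d) m ≈ convolution n (suc d) m + y (suc n) * convolution n d m
    convolution-suc-vars n d m = begin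
      sumTo R d (λ k → coeff m k * esymRec y (suc n) (suc d ∸ k)) + coeff m (suc d) * esymRec y (suc n) (d ∸ d)
        ≈⟨ +-cong (sumTo-cong d inner) (reflexive lastTerm) ⟩
      sumTo R d (λ k → low k + y (suc n) * high k) + low (suc d)
        ≈⟨ +-cong (trans (sumTo-+ d _ _) (+-cong refl (sumTo-*ˡ d (y (suc n)) high))) refl ⟩
      (sumTo R d low + y (suc n) * sumTo R d high) + low (suc d)
        ≈⟨ xy∙z≈xz∙y _ _ _ ⟩
      convolution n (suc d) m + y (suc n) * convolution n d m ∎
      where
      low high : ℕ → Carrier
      low k = coeff m k * esymRec y n (suc d ∸ k)
      high k = coeff m k * esymRec y n (d ∸ k)

      inner : ∀ k → k ≤ d → coeff m k * esymRec y (suc n) (suc d ∸ k) ≈ low k + y (suc n) * high k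
      inner k k≤d rewrite ℕₚ.+-∸-assoc 1 k≤d = begin
        coeff m k * esymRec y (suc n) (suc (d ∸ k))
          ≈⟨ *-cong refl (esymRec-snoc y n (d ∸ k)) ⟩
        coeff m k * (esymRec y n (suc (d ∸ k)) + y (suc n) * esymRec y n (d ∸ k))
          ≈⟨ trans (distribˡ _ _ _) (+-cong refl (x∙yz≈y∙xz _ _ _)) ⟩
        coeff m k * esymRec y n (suc (d ∸ k)) + y (suc n) * high k ∎

      lastTerm : coeff m (suc d) * esymRec y (suc n) (d ∸ d) ≡ low (suc d)
      lastTerm rewrite ℕₚ.n∸n≡0 d = ≡.refl

    arr≈convolution : ∀ n m → arr R x y z n m ≈ convolution n n m
    arr≈convolution zero m = sym (begin
      x (m ℕ.+ 0) * 1# * 1#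
        ≈⟨ trans (*-identityʳ _) (*-identityʳ _) ⟩
      x (m ℕ.+ 0)
        ≡⟨ ≡.cong x (ℕₚ.+-identityʳ m) ⟩
      x m ∎)
    arr≈convolution (suc n) m = begin
      z m * arr R x y z n (suc m) + y (suc n) * arr R x y z n m
        ≈⟨ +-cong (*-cong refl (arr≈convolution n (suc m))) (*-cong refl (arr≈convolution n m)) ⟩
      z m * convolution n n (suc m) + y (suc n) * convolution n n m
        ≈⟨ +-cong (sym (convolution-suc-degree m ℕₚ.≤-refl)) refl ⟩
      convolution n (suc n) m + y (suc n) * convolution n n m
        ≈⟨ sym (convolution-suc-vars n n m) ⟩
      convolution (suc n) (suc n) m ∎

mainTheorem4 : {c ℓ : Level} (R : CommutativeRing c ℓ) →
    let open CommutativeRing R in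
    (x y z : ℕ → Carrier) → (n m : ℕ) →
      arr R x y z n m ≈ sumTo R n (λ k → x (m ℕ.+ k) * prodFrom R z m k * esym R n y (n ℕ.∸ k))
mainTheorem4 R x y z n m =
  trans (arr≈convolution n m) (sumTo-cong R n (λ k _ → *-cong refl (sym (esym≈esymRec R y n (n ∸ k)))))
  where
  open CommutativeRing R
  open ClosedForm R x y z
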